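{- For every integer $r\geq 2$ and every $n\geq G(3,3;r)$, every $r$-coloring of the edges of $K_n$ contains at least $\left(\frac{n}{G(3,3;r)}\right)^3$ triangles that are rainbow or monochromatic.
   Context: An $r$-coloring of the edges of a graph assigns one of $r$ colors to each edge. A triangle is rainbow if its three edges have pairwise distinct colors and monochromatic if its three edges have the same color. $G(3,3;r)$ is the minimum integer $N$ such that every $r$-coloring of the edges of the complete graph on $N$ vertices admits either a rainbow triangle or a monochromatic triangle. -}

module Defs where

open import Data.Nat using (ℕ; _≤_; _^_; _*_)
open import Data.Fin using (Fin; _<_; _<?_)
open import Data.Fin.Properties using (_≟_)
open import Data.List using (List; length; filter; concatMap; map)
open import Data.List.Base using (allFin)
open import Data.Product using (Σ; _×_; _,_; ∃)
open import Data.Sum using (_⊎_)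
open import Relation.Binary.PropositionalEquality using (_≡_; _≢_)
open import Relation.Nullary using (Dec; ¬_)
open import Relation.Nullary.Decidable using (_×-dec_; _⊎-dec_; ¬?)

-- An r-coloring of the edges of K_n: a symmetric map on pairs of vertices
-- (values on the diagonal i = i are irrelevant: no edge there).
Coloring : ℕ → ℕ → Set
Coloring r n = Σ (Fin n → Fin n → Fin r) (λ c → ∀ i j → c i j ≡ c j i)

Rainbow : ∀ {r n} → Coloring r n → Fin n → Fin n → Fin n → Set
Rainbow (c , _) i j k = c i j ≢ c j k × c i j ≢ c i k × c j k ≢ c i k

Mono : ∀ {r n} → Coloring r n → Fin n → Fin n → Fin n → Set
Mono (c , _) i j k = c i j ≡ c j k × c j k ≡ c i k

GoodTriangle : ∀ {r n} → Coloring r n → Fin n × Fin n × Fin n → Set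
GoodTriangle χ (i , j , k) = i < j × j < k × (Rainbow χ i j k ⊎ Mono χ i j k)

goodTriangle? : ∀ {r n} (χ : Coloring r n) (t : Fin n × Fin n × Fin n) → Dec (GoodTriangle χ t)
goodTriangle? (c , s) (i , j , k) =
  (i <? j) ×-dec ((j <? k) ×-dec
    (((¬? (c i j ≟ c j k)) ×-dec ((¬? (c i j ≟ c i k)) ×-dec (¬? (c j k ≟ c i k))))
      ⊎-dec ((c i j ≟ c j k) ×-dec (c j k ≟ c i k))))

allTriples : (n : ℕ) → List (Fin n × Fin n × Fin n)
allTriples n = concatMap (λ i → concatMap (λ j → map (λ k → (i , j , k)) (allFin n)) (allFin n)) (allFin n)

#goodTriangles : ∀ {r n} → Coloring r n → ℕ
#goodTriangles {n = n} χ = length (filter (goodTriangle? χ) (allTriples n))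

Forces : ℕ → ℕ → Set
Forces r N = ∀ (χ : Coloring r N) →
  ∃ λ (t : Fin N × Fin N × Fin N) → GoodTriangle χ t

IsG333 : ℕ → ℕ → Set
IsG333 r G = Forces r G × (∀ N → Forces r N → G ≤ N)

-- Call a triangle good if it is rainbow or monochromatic, and let T(χ) count the good
-- triangles of a coloring χ of K_n. Each triangle survives the deletion of exactly n - 3 of
-- the n vertices, so (n - 3) T(χ) is the sum of T over the n one-vertex deletions of χ, and
-- therefore T(χ) / C(n, 3) is at least the minimum of T / C(n - 1, 3) over colorings of
-- K_(n-1). By induction from n = G, where every coloring has a good triangle,
-- T(χ) ≥ C(n, 3) / C(G, 3), and C(n, 3) / C(G, 3) ≥ (n / G)³ for n ≥ G ≥ 3.
module Submission where

open import Defs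
open import Data.Bool.Base using (true; false; if_then_else_)
open import Data.Fin.Base as Fin using (Fin; punchIn)
open import Data.Fin.Properties using (punchIn-mono-≤; punchIn-cancel-≤; toℕ<n)
open import Data.List.Base using (List; length; filter; concat; concatMap; map; tabulate; allFin; _++_)
open import Data.List.Properties using (length-++; filter-++; map-tabulate)
open import Data.Nat.Base using (ℕ; zero; suc; _≤_; _<_; _≤′_; ≤′-refl; ≤′-step; >-nonZero; _^_; _*_; _+_; z≤n; s≤s)
open import Data.Nat.Properties
open import Algebra.Properties.Semiring.Sum +-*-semiring
  using (sum; sum-syntax; sum-cong-≗; sum-remove; ∑-distrib-+; ∑-comm; *-distribʳ-sum)
open import Data.Nat.Tactic.RingSolver using (solve-∀)
open import Data.Product.Base using (_×_; _,_)
import Data.Product.Base as Product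
open import Data.Vec.Functional using (Vector; removeAt)
open import Function.Base using (id; _∘_)
open import Function.Bundles using (_⇔_; mk⇔)
open import Relation.Binary.PropositionalEquality
open import Relation.Nullary.Decidable using (Dec; does; dec-true; dec-false; does-⇔)
open import Relation.Nullary.Negation using (¬_)
open import Relation.Unary using (Pred; Decidable)

∑-const : ∀ n x → ∑[ i < n ] x ≡ n * x
∑-const zero    x = refl
∑-const (suc n) x = cong (x +_) (∑-const n x)

sum-zero : ∀ {n} (t : Vector ℕ n) → (∀ i → t i ≡ 0) → sum t ≡ 0
sum-zero {n} t t≡0 = trans (sum-cong-≗ t≡0) (trans (∑-const n 0) (*-zeroʳ n))

sum-mono-≤ : ∀ {n} {s t : Vector ℕ n} → (∀ i → s i ≤ t i) → sum s ≤ sum t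
sum-mono-≤ {zero}  s≤t = z≤n
sum-mono-≤ {suc n} s≤t = +-mono-≤ (s≤t Fin.zero) (sum-mono-≤ (s≤t ∘ Fin.suc))

≤-sum : ∀ {n} (t : Vector ℕ n) i → t i ≤ sum t
≤-sum {suc n} t i = ≤-trans (m≤m+n (t i) _) (≤-reflexive (sym (sum-remove {i = i} t)))

sum-removeAt-zero : ∀ {n} (t : Vector ℕ (suc n)) i → t i ≡ 0 → sum (removeAt t i) ≡ sum t
sum-removeAt-zero t i tᵢ≡0 = sym (trans (sum-remove {i = i} t) (cong (_+ sum (removeAt t i)) tᵢ≡0))

indicator : ∀ {p} {P : Set p} → Dec P → ℕ
indicator P? = if does P? then 1 else 0

indicator-yes : ∀ {p} {P : Set p} (P? : Dec P) → P → indicator P? ≡ 1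
indicator-yes P? p = cong (if_then 1 else 0) (dec-true P? p)

indicator-⇔ : ∀ {p q} {P : Set p} {Q : Set q} → P ⇔ Q →
  (P? : Dec P) (Q? : Dec Q) → indicator P? ≡ indicator Q?
indicator-⇔ P⇔Q P? Q? = cong (if_then 1 else 0) (does-⇔ P⇔Q P? Q?)

module _ {a p} {A : Set a} {P : Pred A p} (P? : Decidable P) where

  length-filter-tabulate : ∀ {n} (f : Fin n → A) →
    length (filter P? (tabulate f)) ≡ ∑[ i < n ] indicator (P? (f i))
  length-filter-tabulate {zero}  f = refl
  length-filter-tabulate {suc n} f with does (P? (f Fin.zero))
  ... | true  = cong suc (length-filter-tabulate (f ∘ Fin.suc))
  ... | false = length-filter-tabulate (f ∘ Fin.suc)

  length-filter-concat-tabulate : ∀ {n} (f : Fin n → List A) →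
    length (filter P? (concat (tabulate f))) ≡ ∑[ i < n ] length (filter P? (f i))
  length-filter-concat-tabulate {zero}  f = refl
  length-filter-concat-tabulate {suc n} f = begin
    length (filter P? (f Fin.zero ++ concat (tabulate (f ∘ Fin.suc))))
      ≡⟨ cong length (filter-++ P? (f Fin.zero) _) ⟩
    length (filter P? (f Fin.zero) ++ filter P? (concat (tabulate (f ∘ Fin.suc))))
      ≡⟨ length-++ (filter P? (f Fin.zero)) ⟩
    length (filter P? (f Fin.zero)) + length (filter P? (concat (tabulate (f ∘ Fin.suc))))
      ≡⟨ cong (length (filter P? (f Fin.zero)) +_) (length-filter-concat-tabulate (f ∘ Fin.suc)) ⟩
    ∑[ i < suc n ] length (filter P? (f i)) ∎
    where open ≡-Reasoning

  length-filter-map-allFin : ∀ {n} (f : Fin n → A) →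
    length (filter P? (map f (allFin n))) ≡ ∑[ i < n ] indicator (P? (f i))
  length-filter-map-allFin f = trans (cong (length ∘ filter P?) (map-tabulate id f)) (length-filter-tabulate f)

  length-filter-concatMap-allFin : ∀ {n} (f : Fin n → List A) →
    length (filter P? (concatMap f (allFin n))) ≡ ∑[ i < n ] length (filter P? (f i))
  length-filter-concatMap-allFin f =
    trans (cong (length ∘ filter P? ∘ concat) (map-tabulate id f)) (length-filter-concat-tabulate f)

isGood : ∀ {r n} → Coloring r n → Fin n → Fin n → Fin n → ℕ
isGood χ i j k = indicator (goodTriangle? χ (i , j , k))

∑³ : ∀ {n} → (Fin n → Fin n → Fin n → ℕ) → ℕ
∑³ {n} g = ∑[ i < n ] ∑[ j < n ] ∑[ k < n ] g i j k

#goodTriangles≡∑³isGood : ∀ {r n} (χ : Coloring r n) → #goodTriangles χ ≡ ∑³ (isGood χ)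
#goodTriangles≡∑³isGood {n = n} χ =
  trans (length-filter-concatMap-allFin P? λ i → concatMap (λ j → map (λ k → i , j , k) (allFin n)) (allFin n))
    (sum-cong-≗ λ i → trans (length-filter-concatMap-allFin P? λ j → map (λ k → i , j , k) (allFin n))
      (sum-cong-≗ λ j → length-filter-map-allFin P? (λ k → i , j , k)))
  where P? = goodTriangle? χ

removeAt³ : ∀ {n} → (Fin (suc n) → Fin (suc n) → Fin (suc n) → ℕ) →
  Fin (suc n) → Fin n → Fin n → Fin n → ℕ
removeAt³ g v i j k = g (punchIn v i) (punchIn v j) (punchIn v k)

module _ {n : ℕ} (g : Fin (suc n) → Fin (suc n) → Fin (suc n) → ℕ)
         (g-iik : ∀ i k → g i i k ≡ 0) (g-ijj : ∀ i j → g i j j ≡ 0) (g-iji : ∀ i j → g i j i ≡ 0) where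

  private
    pI = punchIn

    first second third : Fin (suc n) → ℕ
    first  v = ∑[ j < suc n ] ∑[ k < suc n ] g v j k
    second v = ∑[ i < n ] ∑[ k < suc n ] g (pI v i) v k
    third  v = ∑[ i < n ] ∑[ j < n ] g (pI v i) (pI v j) v

    ∑³-split : ∀ v → ∑³ g ≡ first v + (second v + (third v + ∑³ (removeAt³ g v)))
    ∑³-split v = begin
      ∑³ g
        ≡⟨ sum-remove {i = v} (λ i → ∑[ j < suc n ] ∑[ k < suc n ] g i j k) ⟩
      first v + ∑[ i < n ] ∑[ j < suc n ] ∑[ k < suc n ] g (pI v i) j k
        ≡⟨ cong (first v +_) (sum-cong-≗ λ i → sum-remove {i = v} (λ j → ∑[ k < suc n ] g (pI v i) j k)) ⟩
      first v + ∑[ i < n ] (∑[ k < suc n ] g (pI v i) v k + ∑[ j < n ] ∑[ k < suc n ] g (pI v i) (pI v j) k)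
        ≡⟨ cong (first v +_) (∑-distrib-+ (λ i → ∑[ k < suc n ] g (pI v i) v k)
                                           (λ i → ∑[ j < n ] ∑[ k < suc n ] g (pI v i) (pI v j) k)) ⟩
      first v + (second v + ∑[ i < n ] ∑[ j < n ] ∑[ k < suc n ] g (pI v i) (pI v j) k)
        ≡⟨ cong (λ x → first v + (second v + x))
             (sum-cong-≗ λ i → sum-cong-≗ λ j → sum-remove {i = v} (g (pI v i) (pI v j))) ⟩
      first v + (second v + ∑[ i < n ] ∑[ j < n ] (g (pI v i) (pI v j) v + ∑[ k < n ] removeAt³ g v i j k))
        ≡⟨ cong (λ x → first v + (second v + x))
             (trans (sum-cong-≗ λ i → ∑-distrib-+ (λ j → g (pI v i) (pI v j) v) (λ j → ∑[ k < n ] removeAt³ g v i j k))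
                    (∑-distrib-+ (λ i → ∑[ j < n ] g (pI v i) (pI v j) v) (λ i → ∑[ j < n ] ∑[ k < n ] removeAt³ g v i j k))) ⟩
      first v + (second v + (third v + ∑³ (removeAt³ g v))) ∎
      where open ≡-Reasoning

    ∑second : ∑[ v < suc n ] second v ≡ ∑³ g
    ∑second = begin
      ∑[ v < suc n ] second v
        ≡⟨ sum-cong-≗ (λ v → sum-removeAt-zero (λ i → ∑[ k < suc n ] g i v k) v (sum-zero (g v v) (g-iik v))) ⟩
      ∑[ v < suc n ] ∑[ i < suc n ] ∑[ k < suc n ] g i v k
        ≡⟨ ∑-comm (λ v i → ∑[ k < suc n ] g i v k) ⟩
      ∑³ g ∎
      where open ≡-Reasoning

    ∑third : ∑[ v < suc n ] third v ≡ ∑³ g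
    ∑third = begin
      ∑[ v < suc n ] third v
        ≡⟨ sum-cong-≗ (λ v → sum-cong-≗ λ i → sum-removeAt-zero (λ j → g (pI v i) j v) v (g-ijj (pI v i) v)) ⟩
      ∑[ v < suc n ] ∑[ i < n ] ∑[ j < suc n ] g (pI v i) j v
        ≡⟨ sum-cong-≗ (λ v → sum-removeAt-zero (λ i → ∑[ j < suc n ] g i j v) v (sum-zero (λ j → g v j v) (g-iji v))) ⟩
      ∑[ v < suc n ] ∑[ i < suc n ] ∑[ j < suc n ] g i j v
        ≡⟨ trans (∑-comm (λ v i → ∑[ j < suc n ] g i j v)) (sum-cong-≗ λ i → ∑-comm (λ v j → g i j v)) ⟩
      ∑³ g ∎
      where open ≡-Reasoning

  ∑-∑³-removeAt³ : suc n * ∑³ g ≡ 3 * ∑³ g + ∑[ v < suc n ] ∑³ (removeAt³ g v)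
  ∑-∑³-removeAt³ = begin
    suc n * ∑³ g
      ≡⟨ sym (∑-const (suc n) (∑³ g)) ⟩
    ∑[ v < suc n ] ∑³ g
      ≡⟨ sum-cong-≗ ∑³-split ⟩
    ∑[ v < suc n ] (first v + (second v + (third v + ∑³ (removeAt³ g v))))
      ≡⟨ trans (∑-distrib-+ first λ v → second v + (third v + ∑³ (removeAt³ g v)))
          (cong (∑³ g +_) (trans (∑-distrib-+ second λ v → third v + ∑³ (removeAt³ g v))
            (cong (∑[ v < suc n ] second v +_) (∑-distrib-+ third λ v → ∑³ (removeAt³ g v))))) ⟩
    ∑³ g + (∑[ v < suc n ] second v + (∑[ v < suc n ] third v + R))
      ≡⟨ cong₂ (λ x y → ∑³ g + (x + (y + R))) ∑second ∑third ⟩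
    ∑³ g + (∑³ g + (∑³ g + R))
      ≡⟨ threefold (∑³ g) R ⟩
    3 * ∑³ g + R ∎
    where
    open ≡-Reasoning
    R = ∑[ v < suc n ] ∑³ (removeAt³ g v)
    threefold : ∀ s t → s + (s + (s + t)) ≡ 3 * s + t
    threefold = solve-∀

restrict : ∀ {r n} → Coloring r (suc n) → Fin (suc n) → Coloring r n
restrict (c , c-sym) v = (λ i j → c (punchIn v i) (punchIn v j)) , (λ i j → c-sym (punchIn v i) (punchIn v j))

punchIn-mono-< : ∀ {n} (v : Fin (suc n)) {i j : Fin n} → i Fin.< j → punchIn v i Fin.< punchIn v j
punchIn-mono-< v {i} {j} i<j = ≰⇒> (λ pj≤pi → <⇒≱ i<j (punchIn-cancel-≤ v j i pj≤pi))

punchIn-cancel-< : ∀ {n} (v : Fin (suc n)) {i j : Fin n} → punchIn v i Fin.< punchIn v j → i Fin.< j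
punchIn-cancel-< v {i} {j} pi<pj = ≰⇒> (λ j≤i → <⇒≱ pi<pj (punchIn-mono-≤ v j i j≤i))

goodTriangle-restrict : ∀ {r n} (χ : Coloring r (suc n)) v i j k →
  GoodTriangle (restrict χ v) (i , j , k) ⇔ GoodTriangle χ (punchIn v i , punchIn v j , punchIn v k)
goodTriangle-restrict χ v i j k =
  mk⇔ (Product.map (punchIn-mono-< v) (Product.map₁ (punchIn-mono-< v)))
      (Product.map (punchIn-cancel-< v) (Product.map₁ (punchIn-cancel-< v)))

isGood-restrict : ∀ {r n} (χ : Coloring r (suc n)) v i j k →
  isGood (restrict χ v) i j k ≡ removeAt³ (isGood χ) v i j k
isGood-restrict χ v i j k = indicator-⇔ (goodTriangle-restrict χ v i j k)
  (goodTriangle? (restrict χ v) (i , j , k)) (goodTriangle? χ (punchIn v i , punchIn v j , punchIn v k))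

isGood-unordered : ∀ {r n} (χ : Coloring r n) i j k → ¬ (i Fin.< j × j Fin.< k) → isGood χ i j k ≡ 0
isGood-unordered χ i j k ¬ordered =
  cong (if_then 1 else 0) (dec-false (goodTriangle? χ (i , j , k)) (¬ordered ∘ Product.map₂ Product.proj₁))

∑-∑³isGood-restrict : ∀ {r n} (χ : Coloring r (3 + n)) →
  ∑[ v < 3 + n ] ∑³ (isGood (restrict χ v)) ≡ n * ∑³ (isGood χ)
∑-∑³isGood-restrict {n = n} χ = +-cancelˡ-≡ (3 * S) _ _ (begin
  3 * S + ∑[ v < 3 + n ] ∑³ (isGood (restrict χ v))
    ≡⟨ cong (3 * S +_) (sum-cong-≗ λ v → sum-cong-≗ λ i → sum-cong-≗ λ j → sum-cong-≗ λ k → isGood-restrict χ v i j k) ⟩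
  3 * S + ∑[ v < 3 + n ] ∑³ (removeAt³ (isGood χ) v)
    ≡⟨ sym (∑-∑³-removeAt³ (isGood χ) iik ijj iji) ⟩
  (3 + n) * S
    ≡⟨ *-distribʳ-+ S 3 n ⟩
  3 * S + n * S ∎)
  where
  open ≡-Reasoning
  S = ∑³ (isGood χ)
  iik : ∀ i k → isGood χ i i k ≡ 0
  iik i k = isGood-unordered χ i i k λ (i<i , _) → <-irrefl refl i<i
  ijj : ∀ i j → isGood χ i j j ≡ 0
  ijj i j = isGood-unordered χ i j j λ (_ , j<j) → <-irrefl refl j<j
  iji : ∀ i j → isGood χ i j i ≡ 0
  iji i j = isGood-unordered χ i j i λ (i<j , j<i) → <-asym i<j j<i

forces⇒1≤∑³isGood : ∀ {r n} → Forces r n → (χ : Coloring r n) → 1 ≤ ∑³ (isGood χ)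
forces⇒1≤∑³isGood forces χ with forces χ
... | (i , j , k) , good = begin
  1                                    ≡⟨ sym (indicator-yes (goodTriangle? χ (i , j , k)) good) ⟩
  isGood χ i j k                       ≤⟨ ≤-sum (isGood χ i j) k ⟩
  ∑[ k < _ ] isGood χ i j k            ≤⟨ ≤-sum (λ j → ∑[ k < _ ] isGood χ i j k) j ⟩
  ∑[ j < _ ] ∑[ k < _ ] isGood χ i j k ≤⟨ ≤-sum (λ i → ∑[ j < _ ] ∑[ k < _ ] isGood χ i j k) i ⟩
  ∑³ (isGood χ)                        ∎
  where open ≤-Reasoning

-- n (n - 1) (n - 2) = 3! C(n, 3) at n = 3 + t; the shift avoids truncated subtraction.
falling₃ : ℕ → ℕ
falling₃ t = (3 + t) * (2 + t) * (1 + t)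

falling₃-suc : ∀ t → (1 + t) * falling₃ (1 + t) ≡ (4 + t) * falling₃ t
falling₃-suc t = expanded t
  where
  expanded : ∀ t → (1 + t) * ((4 + t) * (3 + t) * (2 + t)) ≡ (4 + t) * ((3 + t) * (2 + t) * (1 + t))
  expanded = solve-∀

module _ {r g : ℕ} (forces : Forces r (3 + g)) where

  falling₃≤∑³isGood : ∀ {t} → g ≤′ t → (χ : Coloring r (3 + t)) →
    falling₃ t ≤ ∑³ (isGood χ) * falling₃ g
  falling₃≤∑³isGood ≤′-refl χ = m≤n*m (falling₃ g) _ {{>-nonZero (forces⇒1≤∑³isGood forces χ)}}
  falling₃≤∑³isGood {suc t} (≤′-step g≤t) χ = *-cancelˡ-≤ (1 + t) (begin
    (1 + t) * falling₃ (1 + t)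
      ≡⟨ falling₃-suc t ⟩
    (4 + t) * falling₃ t
      ≡⟨ sym (∑-const (4 + t) (falling₃ t)) ⟩
    ∑[ v < 4 + t ] falling₃ t
      ≤⟨ sum-mono-≤ (λ v → falling₃≤∑³isGood g≤t (restrict χ v)) ⟩
    ∑[ v < 4 + t ] (∑³ (isGood (restrict χ v)) * falling₃ g)
      ≡⟨ sym (*-distribʳ-sum (falling₃ g) (λ v → ∑³ (isGood (restrict χ v)))) ⟩
    (∑[ v < 4 + t ] ∑³ (isGood (restrict χ v))) * falling₃ g
      ≡⟨ cong (_* falling₃ g) (∑-∑³isGood-restrict χ) ⟩
    (1 + t) * ∑³ (isGood χ) * falling₃ g
      ≡⟨ *-assoc (1 + t) (∑³ (isGood χ)) (falling₃ g) ⟩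
    (1 + t) * (∑³ (isGood χ) * falling₃ g) ∎)
    where open ≤-Reasoning

falling₃-ratio : ∀ {g t} → g ≤ t → (3 + t) ^ 3 * falling₃ g ≤ (3 + g) ^ 3 * falling₃ t
falling₃-ratio {g} g≤t with d , refl ← m≤n⇒∃[o]m+o≡n g≤t =
  ≤-trans (m≤m+n _ _) (≤-reflexive (sym (expanded g d)))
  where
  -- The solver does not know _^_, so x ^ 3 is written as its unfolding x * (x * (x * 1)).
  expanded : ∀ g d → (3 + g) * ((3 + g) * ((3 + g) * 1)) * ((3 + (g + d)) * (2 + (g + d)) * (1 + (g + d)))
                   ≡ (3 + (g + d)) * ((3 + (g + d)) * ((3 + (g + d)) * 1)) * ((3 + g) * (2 + g) * (1 + g))
                     + (3 + g + d) * (3 + g) * d * (3 * g * g + 14 * g + 15 + d * (3 * g + 7))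
  expanded = solve-∀

forces⇒3≤ : ∀ {r n} → 0 < r → Forces r n → 3 ≤ n
forces⇒3≤ {suc r} _ forces with forces ((λ _ _ → Fin.zero) , λ _ _ → refl)
... | (i , j , k) , i<j , j<k , _ = ≤-trans (s≤s (≤-trans (s≤s (≤-trans (s≤s z≤n) i<j)) j<k)) (toℕ<n k)

cube-bound : ∀ {r g t} → Forces r (3 + g) → g ≤ t → (χ : Coloring r (3 + t)) →
  (3 + t) ^ 3 ≤ ∑³ (isGood χ) * (3 + g) ^ 3
cube-bound {g = g} {t} forces g≤t χ = ≤-trans G³S-bound (≤-reflexive (*-comm ((3 + g) ^ 3) S))
  where
  S = ∑³ (isGood χ)
  G³S-bound : (3 + t) ^ 3 ≤ (3 + g) ^ 3 * S
  G³S-bound = *-cancelʳ-≤ ((3 + t) ^ 3) ((3 + g) ^ 3 * S) (falling₃ g) (begin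
    (3 + t) ^ 3 * falling₃ g    ≤⟨ falling₃-ratio g≤t ⟩
    (3 + g) ^ 3 * falling₃ t    ≤⟨ *-monoʳ-≤ ((3 + g) ^ 3) (falling₃≤∑³isGood forces (≤⇒≤′ g≤t) χ) ⟩
    (3 + g) ^ 3 * (S * falling₃ g) ≡⟨ sym (*-assoc ((3 + g) ^ 3) S (falling₃ g)) ⟩
    (3 + g) ^ 3 * S * falling₃ g ∎)
    where open ≤-Reasoning

corollary4p2 : ∀ (r G : ℕ) → 2 ≤ r → IsG333 r G →
    ∀ (n : ℕ) → G ≤ n → (χ : Coloring r n) →
    n ^ 3 ≤ #goodTriangles χ * G ^ 3
corollary4p2 r G 2≤r (forces , _) n G≤n χ with forces⇒3≤ (≤-trans (s≤s z≤n) 2≤r) forces | G≤n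
... | s≤s (s≤s (s≤s _)) | s≤s (s≤s (s≤s g≤t)) =
  subst (λ m → n ^ 3 ≤ m * G ^ 3) (sym (#goodTriangles≡∑³isGood χ)) (cube-bound forces g≤t χ)
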